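{- Let $r\ge 2$ be a fixed integer and let $H$ be an $r$-uniform hypergraph on $n$ vertices of girth $6$, i.e. $H$ contains no Berge cycle of length less than six. Then $$|E(H)| \le (1+o(1))\frac{n^{3/2}}{r^{3/2}(r-1)},$$ where $o(1)$ denotes a quantity tending to $0$ as $n\to\infty$ (with $r$ fixed).
   Context: A Berge cycle of length $k\ge 2$ in a hypergraph is a sequence of $k$ distinct vertices $v_1,\dots,v_k$ and $k$ distinct hyperedges $h_1,\dots,h_k$ such that $v_i,v_{i+1}\in h_i$ for all $i$ (indices modulo $k$). In particular, having no Berge cycle of length $2$ means any two hyperedges share at most one vertex. -}

module Defs where

open import Data.Nat using (ℕ; zero; suc; _+_; _*_; _^_; _≤_; _<_)
open import Data.Nat.DivMod using (_%_; m%n<n)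
open import Data.Fin using (Fin; toℕ; fromℕ<)
open import Data.Fin.Subset using (Subset; _∈_; ∣_∣)
open import Data.Product using (Σ; _×_)
open import Function.Definitions using (Injective)
open import Relation.Binary.PropositionalEquality using (_≡_)
open import Relation.Nullary using (¬_)

record UniformHypergraph (r n : ℕ) : Set where
  field
    m        : ℕ
    edge     : Fin m → Subset n
    distinct : Injective _≡_ _≡_ edge
    uniform  : ∀ e → ∣ edge e ∣ ≡ r

open UniformHypergraph public

next : ∀ {k} → Fin (suc k) → Fin (suc k)
next {k} i = fromℕ< (m%n<n (suc (toℕ i)) (suc k))

record BergeCycle {r n : ℕ} (H : UniformHypergraph r n) (k : ℕ) : Set where
  field
    v      : Fin (suc k) → Fin n
    h      : Fin (suc k) → Fin (m H)
    v-inj  : Injective _≡_ _≡_ v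
    h-inj  : Injective _≡_ _≡_ h
    v∈h    : ∀ i → v i ∈ edge H (h i)
    v'∈h   : ∀ i → v (next i) ∈ edge H (h i)

-- girth 6 (as in the paper): no Berge cycle of length ℓ with 2 ≤ ℓ < 6.
-- A cycle of length suc k has 2 ≤ suc k < 6 iff 1 ≤ k ≤ 4.
HasGirth6 : ∀ {r n} → UniformHypergraph r n → Set
HasGirth6 H = ∀ k → 1 ≤ k → k ≤ 4 → ¬ BergeCycle H k

-- Girth 6 makes H linear and free of Berge cycles of length 3, 4 and 5.  Hence two vertices are
-- joined by at most one Berge path with two edges, and an edge e reaches a vertex c by at most one
-- path e ∋ a, a -g- b -f- c with g ≠ e.  Counting both kinds of paths through the degrees d gives
--   (r-1)² Σ d(a)(d(a)-1) ≤ n²   and   (r-1) Σ (d(a)-1)(d(b)-1) ≤ |E| n,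
-- the second sum running over the T = (r-1) r |E| ordered pairs a ≠ b of vertices of a common edge.
-- Over these pairs Σ 1/d(a) = (r-1) n, so Hölder's inequality (pointwise AM-GM for d(a)d(b), 1/d(a)
-- and 1/d(b)) gives T³ ≤ ((r-1) n)² Σ d(a)d(b).  The two counts bound Σ d(a)d(b) by |E| n/(r-1)
-- plus terms of order n², and together (r-1)² r³ |E|³ ≤ n³ |E| + O(n⁴ + |E| n²).

module Submission where

open import Defs
open import Data.Nat using (ℕ; zero; suc; _+_; _*_; _^_; _∸_; _≤_; _<_; _≤?_; z≤n; s≤s; >-nonZero)
open import Data.Nat.Properties hiding (_≟_; suc-injective)
open import Data.Nat.DivMod using (_/_; _%_; m≡m%n+[m/n]*n; m/n*n≤m; m%n<n)
open import Data.Nat.Tactic.RingSolver using (solve-∀)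
open import Data.Bool using (Bool; true; false; not)
open import Data.Fin using (Fin; zero; suc)
open import Data.Fin.Properties using (_≟_; suc-injective)
open import Data.Fin.Subset using (Subset; _∈_; ∣_∣)
open import Data.Vec using (Vec; []; _∷_; lookup; tabulate)
open import Data.Vec.Properties using (lookup∘tabulate; lookup⇒[]=)
open import Data.Vec.Relation.Unary.AllPairs using ([]; _∷_)
open import Data.Vec.Relation.Unary.All using ([]; _∷_)
open import Data.Vec.Relation.Unary.Unique.Propositional using (Unique)
open import Data.Vec.Relation.Unary.Unique.Propositional.Properties using (lookup-injective)
open import Data.Vec.Relation.Binary.Pointwise.Inductive as Pointwise using (Pointwise; []; _∷_)
open import Data.Product using (Σ; _×_; _,_; proj₁; proj₂; ∃)
open import Data.Sum using (inj₁; inj₂)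
open import Data.Empty using (⊥; ⊥-elim)
open import Function using (_∘_)
open import Relation.Binary.PropositionalEquality
open import Relation.Nullary using (¬_; yes; no; contradiction)
open import Relation.Nullary.Decidable using (does; True; toWitness)
open import Algebra.Properties.Semiring.Sum +-*-semiring
  using (sum; sum-syntax; sum-cong-≗; ∑-distrib-+; ∑-comm; *-distribˡ-sum; *-distribʳ-sum)

𝟙 : Bool → ℕ
𝟙 true  = 1
𝟙 false = 0

-- Built from `does` rather than ⌊_⌋, so that ⟦ suc i ≠ suc j ⟧ reduces to ⟦ i ≠ j ⟧.
⟦_≠_⟧ : ∀ {k} → Fin k → Fin k → ℕ
⟦ i ≠ j ⟧ = 𝟙 (not (does (i ≟ j)))

𝟙≤1 : ∀ b → 𝟙 b ≤ 1
𝟙≤1 true  = s≤s z≤n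
𝟙≤1 false = z≤n

𝟙-positive : ∀ {b} → 0 < 𝟙 b → b ≡ true
𝟙-positive {true} _ = refl

⟦≠⟧-positive : ∀ {k} {i j : Fin k} → 0 < ⟦ i ≠ j ⟧ → i ≢ j
⟦≠⟧-positive {i = i} {j} 0<⟦i≠j⟧ i≡j with i ≟ j
... | yes _ = <-irrefl refl 0<⟦i≠j⟧
... | no i≢j = i≢j i≡j

⟦≠⟧-sym : ∀ {k} (i j : Fin k) → ⟦ i ≠ j ⟧ ≡ ⟦ j ≠ i ⟧
⟦≠⟧-sym i j with i ≟ j | j ≟ i
... | yes _   | yes _   = refl
... | no _    | no _    = refl
... | yes i≡j | no j≢i  = contradiction (sym i≡j) j≢i
... | no i≢j  | yes j≡i = contradiction (sym j≡i) i≢j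

*-positive⁻¹ : ∀ {m n} → 0 < m * n → 0 < m × 0 < n
*-positive⁻¹ {suc m} {suc n} _ = s≤s z≤n , s≤s z≤n
*-positive⁻¹ {suc m} {zero} 0<m*0 = contradiction (subst (0 <_) (*-zeroʳ (suc m)) 0<m*0) (<-irrefl refl)

sum-const : ∀ n c → ∑[ i < n ] c ≡ n * c
sum-const zero    c = refl
sum-const (suc n) c = cong (c +_) (sum-const n c)

sum²-const-1 : ∀ a b → ∑[ i < a ] ∑[ j < b ] 1 ≡ a * b
sum²-const-1 a b = trans (sum-cong-≗ {a} {λ _ → ∑[ j < b ] 1} {λ _ → b} (λ _ → trans (sum-const b 1) (*-identityʳ b))) (sum-const a b)

sum-mono-≤ : ∀ {n} {f g : Fin n → ℕ} → (∀ i → f i ≤ g i) → sum f ≤ sum g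
sum-mono-≤ {zero}  f≤g = z≤n
sum-mono-≤ {suc n} f≤g = +-mono-≤ (f≤g zero) (sum-mono-≤ (f≤g ∘ suc))

term≤sum : ∀ {n} (f : Fin n → ℕ) i → f i ≤ sum f
term≤sum f zero    = m≤m+n (f zero) _
term≤sum f (suc i) = ≤-trans (term≤sum (f ∘ suc) i) (m≤n+m _ (f zero))

∑³ : ∀ {a b c} → (Fin a → Fin b → Fin c → ℕ) → ℕ
∑³ {a} {b} {c} F = ∑[ i < a ] ∑[ j < b ] ∑[ k < c ] F i j k

∑³-cong : ∀ {a b c} {F G : Fin a → Fin b → Fin c → ℕ} → (∀ i j k → F i j k ≡ G i j k) → ∑³ F ≡ ∑³ G
∑³-cong F≡G = sum-cong-≗ λ i → sum-cong-≗ λ j → sum-cong-≗ (F≡G i j)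

∑³-mono-≤ : ∀ {a b c} {F G : Fin a → Fin b → Fin c → ℕ} → (∀ i j k → F i j k ≤ G i j k) → ∑³ F ≤ ∑³ G
∑³-mono-≤ F≤G = sum-mono-≤ λ i → sum-mono-≤ λ j → sum-mono-≤ (F≤G i j)

∑³-distrib-+ : ∀ {a b c} (F G : Fin a → Fin b → Fin c → ℕ) → ∑³ (λ i j k → F i j k + G i j k) ≡ ∑³ F + ∑³ G
∑³-distrib-+ {a} {b} {c} F G = trans
  (sum-cong-≗ λ i → trans (sum-cong-≗ λ j → ∑-distrib-+ (F i j) (G i j))
                          (∑-distrib-+ (λ j → ∑[ k < c ] F i j k) (λ j → ∑[ k < c ] G i j k)))
  (∑-distrib-+ (λ i → ∑[ j < b ] ∑[ k < c ] F i j k) (λ i → ∑[ j < b ] ∑[ k < c ] G i j k))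

*-distribˡ-∑³ : ∀ {a b c} x (F : Fin a → Fin b → Fin c → ℕ) → x * ∑³ F ≡ ∑³ (λ i j k → x * F i j k)
*-distribˡ-∑³ {a} {b} {c} x F =
  trans (*-distribˡ-sum x λ i → ∑[ j < b ] ∑[ k < c ] F i j k)
        (sum-cong-≗ λ i → trans (*-distribˡ-sum x λ j → ∑[ k < c ] F i j k) (sum-cong-≗ λ j → *-distribˡ-sum x (F i j)))

sum-positive : ∀ {n} (f : Fin n → ℕ) → 0 < sum f → ∃ λ i → 0 < f i
sum-positive {suc n} f 0<∑f with f zero in f0≡
... | suc _ = zero , subst (0 <_) (sym f0≡) (s≤s z≤n)
... | zero with i , 0<fi ← sum-positive (f ∘ suc) 0<∑f = suc i , 0<fi

sum≤1 : ∀ {n} (f : Fin n → ℕ) → (∀ i → f i ≤ 1) → (∀ {i j} → 0 < f i → 0 < f j → i ≡ j) → sum f ≤ 1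
sum≤1 {zero}  f f≤1 unique = z≤n
sum≤1 {suc n} f f≤1 unique with f zero in f0≡
... | zero  = sum≤1 (f ∘ suc) (f≤1 ∘ suc) (λ p q → suc-injective (unique p q))
... | suc k = begin
  suc k + sum (f ∘ suc)  ≡⟨ cong (suc k +_) tail≡0 ⟩
  suc k + 0              ≡⟨ +-identityʳ (suc k) ⟩
  suc k                  ≡⟨ f0≡ ⟨
  f zero                 ≤⟨ f≤1 zero ⟩
  1                      ∎
  where
    open ≤-Reasoning
    term≡0 : ∀ i → f (suc i) ≤ 0
    term≡0 i with f (suc i) in fi≡
    ... | zero  = z≤n
    ... | suc _ with () ← unique (subst (0 <_) (sym f0≡) (s≤s z≤n)) (subst (0 <_) (sym fi≡) (s≤s z≤n))
    tail≡0 : sum (f ∘ suc) ≡ 0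
    tail≡0 = n≤0⇒n≡0 (≤-trans (sum-mono-≤ term≡0) (≤-reflexive (trans (sum-const n 0) (*-zeroʳ n))))

sum²-positive : ∀ {a b} (F : Fin a → Fin b → ℕ) → 0 < ∑[ i < a ] ∑[ j < b ] F i j → ∃ λ i → ∃ λ j → 0 < F i j
sum²-positive F 0<∑ with i , 0<∑Fi ← sum-positive _ 0<∑ with j , 0<Fij ← sum-positive (F i) 0<∑Fi = i , j , 0<Fij

sum³-positive : ∀ {a b c} (F : Fin a → Fin b → Fin c → ℕ) → 0 < ∑³ F → ∃ λ i → ∃ λ j → ∃ λ k → 0 < F i j k
sum³-positive F 0<∑ with i , 0<∑Fi ← sum-positive _ 0<∑ = i , sum²-positive (F i) 0<∑Fi

sum²≤1 : ∀ {a b} (F : Fin a → Fin b → ℕ) → (∀ i j → F i j ≤ 1) →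
  (∀ {i j i' j'} → 0 < F i j → 0 < F i' j' → i ≡ i' × j ≡ j') → ∑[ i < a ] ∑[ j < b ] F i j ≤ 1
sum²≤1 F F≤1 unique = sum≤1 _ (λ i → sum≤1 (F i) (F≤1 i) (λ p q → proj₂ (unique p q)))
  (λ {i} {i'} p q → proj₁ (unique (proj₂ (sum-positive (F i) p)) (proj₂ (sum-positive (F i') q))))

sum³≤1 : ∀ {a b c} (F : Fin a → Fin b → Fin c → ℕ) → (∀ i j k → F i j k ≤ 1) →
  (∀ {i j k i' j' k'} → 0 < F i j k → 0 < F i' j' k' → i ≡ i' × j ≡ j' × k ≡ k') → ∑³ F ≤ 1
sum³≤1 F F≤1 unique = sum≤1 _ (λ i → sum²≤1 (F i) (F≤1 i) (λ p q → proj₂ (unique p q)))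
  (λ {i} {i'} p q → proj₁ (unique (proj₂ (proj₂ (sum²-positive (F i) p))) (proj₂ (proj₂ (sum²-positive (F i') q)))))

sum⁴≤1 : ∀ {a b c d} (F : Fin a → Fin b → Fin c → Fin d → ℕ) → (∀ i j k l → F i j k l ≤ 1) →
  (∀ {i j k l i' j' k' l'} → 0 < F i j k l → 0 < F i' j' k' l' → i ≡ i' × j ≡ j' × k ≡ k' × l ≡ l') →
  ∑[ i < a ] ∑[ j < b ] ∑[ k < c ] ∑[ l < d ] F i j k l ≤ 1
sum⁴≤1 F F≤1 unique = sum≤1 _ (λ i → sum³≤1 (F i) (F≤1 i) (λ p q → proj₂ (unique p q)))
  (λ {i} {i'} p q → proj₁ (unique (proj₂ (proj₂ (proj₂ (sum³-positive (F i) p)))) (proj₂ (proj₂ (proj₂ (sum³-positive (F i') q))))))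

∑-pull³ : ∀ {a b c} (F : Fin a → Fin b → Fin c → ℕ) → ∑³ F ≡ ∑[ k < c ] ∑[ i < a ] ∑[ j < b ] F i j k
∑-pull³ F = trans (sum-cong-≗ λ i → ∑-comm (F i)) (∑-comm λ i k → ∑[ j < _ ] F i j k)

∑-pull⁴ : ∀ {a b c d} (F : Fin a → Fin b → Fin c → Fin d → ℕ) →
  ∑[ i < a ] ∑[ j < b ] ∑[ k < c ] ∑[ l < d ] F i j k l ≡ ∑[ l < d ] ∑[ i < a ] ∑[ j < b ] ∑[ k < c ] F i j k l
∑-pull⁴ F = trans (sum-cong-≗ λ i → ∑-pull³ (F i)) (∑-comm λ i l → ∑[ j < _ ] ∑[ k < _ ] F i j k l)

∑-pull⁵ : ∀ {a b c d e} (F : Fin a → Fin b → Fin c → Fin d → Fin e → ℕ) →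
  ∑[ i < a ] ∑[ j < b ] ∑[ k < c ] ∑[ l < d ] ∑[ m < e ] F i j k l m ≡
  ∑[ m < e ] ∑[ i < a ] ∑[ j < b ] ∑[ k < c ] ∑[ l < d ] F i j k l m
∑-pull⁵ F = trans (sum-cong-≗ λ i → ∑-pull⁴ (F i)) (∑-comm λ i m → ∑[ j < _ ] ∑[ k < _ ] ∑[ l < _ ] F i j k l m)

∑-reverse³ : ∀ {a b c} (F : Fin a → Fin b → Fin c → ℕ) → ∑³ F ≡ ∑³ (λ k j i → F i j k)
∑-reverse³ F = trans (∑-pull³ F) (sum-cong-≗ λ k → ∑-comm λ i j → F i j k)

sum-others : ∀ {k} (f : Fin k → ℕ) i → ∑[ j < k ] (f j * ⟦ i ≠ j ⟧) + f i ≡ sum f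
sum-others {suc k} f zero = begin
  f zero * 0 + ∑[ j < k ] (f (suc j) * 1) + f zero  ≡⟨ cong (λ s → f zero * 0 + s + f zero) (sum-cong-≗ (*-identityʳ ∘ f ∘ suc)) ⟩
  f zero * 0 + sum (f ∘ suc) + f zero               ≡⟨ regroup (f zero) (sum (f ∘ suc)) ⟩
  f zero + sum (f ∘ suc)                            ∎
  where
    open ≡-Reasoning
    regroup : ∀ x s → x * 0 + s + x ≡ x + s
    regroup = solve-∀
sum-others {suc k} f (suc i) = begin
  f zero * 1 + ∑[ j < k ] (f (suc j) * ⟦ i ≠ j ⟧) + f (suc i)   ≡⟨ +-assoc (f zero * 1) _ _ ⟩
  f zero * 1 + (∑[ j < k ] (f (suc j) * ⟦ i ≠ j ⟧) + f (suc i)) ≡⟨ cong₂ _+_ (*-identityʳ (f zero)) (sum-others (f ∘ suc) i) ⟩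
  f zero + sum (f ∘ suc)                                         ∎
  where open ≡-Reasoning

𝟙*sum-others : ∀ {k} (b : Fin k → Bool) i →
  𝟙 (b i) * ∑[ j < k ] (𝟙 (b j) * ⟦ i ≠ j ⟧) ≡ 𝟙 (b i) * (∑[ j < k ] 𝟙 (b j) ∸ 1)
𝟙*sum-others b i with b i | sum-others (𝟙 ∘ b) i
... | false | _ = refl
... | true  | others+1≡all = cong (1 *_) (sym (trans (cong (_∸ 1) (sym others+1≡all)) (m+n∸n≡m _ 1)))

sum-𝟙-lookup : ∀ {n} (p : Subset n) → ∑[ i < n ] 𝟙 (lookup p i) ≡ ∣ p ∣
sum-𝟙-lookup []          = refl
sum-𝟙-lookup (true ∷ p)  = cong suc (sum-𝟙-lookup p)
sum-𝟙-lookup (false ∷ p) = sum-𝟙-lookup p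

m+n+n≡m+2*n : ∀ m n → m + n + n ≡ m + 2 * n
m+n+n≡m+2*n = solve-∀

2*≤sq+sq : ∀ p s → 2 * (p * s) ≤ p * p + s * s
2*≤sq+sq p s with ≤-total p s
... | inj₁ p≤s with t , refl ← m≤n⇒∃[o]m+o≡n p≤s = ≤-trans (m≤m+n _ (t * t)) (≤-reflexive (expand p t))
  where expand : ∀ p t → 2 * (p * (p + t)) + t * t ≡ p * p + (p + t) * (p + t)
        expand = solve-∀
... | inj₂ s≤p with t , refl ← m≤n⇒∃[o]m+o≡n s≤p = ≤-trans (m≤m+n _ (t * t)) (≤-reflexive (expand s t))
  where expand : ∀ s t → 2 * ((s + t) * s) + t * t ≡ (s + t) * (s + t) + s * s
        expand = solve-∀

products≤squares : ∀ p q s → p * q + q * s + s * p ≤ p * p + q * q + s * s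
products≤squares p q s = *-cancelˡ-≤ 2 (begin
  2 * (p * q + q * s + s * p)                         ≡⟨ expand₁ p q s ⟩
  2 * (p * q) + 2 * (q * s) + 2 * (s * p)             ≤⟨ +-mono-≤ (+-mono-≤ (2*≤sq+sq p q) (2*≤sq+sq q s)) (2*≤sq+sq s p) ⟩
  (p * p + q * q) + (q * q + s * s) + (s * s + p * p) ≡⟨ expand₂ p q s ⟩
  2 * (p * p + q * q + s * s)                         ∎)
  where
    open ≤-Reasoning
    expand₁ : ∀ p q s → 2 * (p * q + q * s + s * p) ≡ 2 * (p * q) + 2 * (q * s) + 2 * (s * p)
    expand₁ = solve-∀
    expand₂ : ∀ p q s → (p * p + q * q) + (q * q + s * s) + (s * s + p * p) ≡ 2 * (p * p + q * q + s * s)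
    expand₂ = solve-∀

-- (p + q + s)(p² + q² + s² - pq - qs - sp) = p³ + q³ + s³ - 3pqs
3*product≤cubes : ∀ p q s → 3 * (p * q * s) ≤ p * p * p + q * q * q + s * s * s
3*product≤cubes p q s = +-cancelʳ-≤ mixed _ _ (begin
  3 * (p * q * s) + mixed                ≡⟨ expand₁ p q s ⟩
  (p + q + s) * (p * q + q * s + s * p)  ≤⟨ *-monoʳ-≤ (p + q + s) (products≤squares p q s) ⟩
  (p + q + s) * (p * p + q * q + s * s)  ≡⟨ expand₂ p q s ⟩
  p * p * p + q * q * q + s * s * s + mixed ∎)
  where
    open ≤-Reasoning
    mixed : ℕ
    mixed = p * p * q + p * p * s + q * q * p + q * q * s + s * s * p + s * s * q
    expand₁ : ∀ p q s → 3 * (p * q * s) + (p * p * q + p * p * s + q * q * p + q * q * s + s * s * p + s * s * q) ≡ (p + q + s) * (p * q + q * s + s * p)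
    expand₁ = solve-∀
    expand₂ : ∀ p q s → (p + q + s) * (p * p + q * q + s * s) ≡ p * p * p + q * q * q + s * s * s + (p * p * q + p * p * s + q * q * p + q * q * s + s * s * p + s * s * q)
    expand₂ = solve-∀

27*product≤cube-of-sum : ∀ p q s → 27 * (p * q * s) ≤ (p + q + s) * (p + q + s) * (p + q + s)
27*product≤cube-of-sum p q s = begin
  27 * (p * q * s)
    ≡⟨ expand₁ p q s ⟩
  3 * (p * q * s) + 3 * (q * (2 * (p * s)) + p * (2 * (q * s)) + s * (2 * (p * q))) + 6 * (p * q * s)
    ≤⟨ +-monoˡ-≤ _ (+-mono-≤ (3*product≤cubes p q s) (*-monoʳ-≤ 3 (+-mono-≤ (+-mono-≤
         (*-monoʳ-≤ q (2*≤sq+sq p s)) (*-monoʳ-≤ p (2*≤sq+sq q s))) (*-monoʳ-≤ s (2*≤sq+sq p q))))) ⟩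
  (p * p * p + q * q * q + s * s * s) + 3 * (q * (p * p + s * s) + p * (q * q + s * s) + s * (p * p + q * q)) + 6 * (p * q * s)
    ≡⟨ expand₂ p q s ⟩
  (p + q + s) * (p + q + s) * (p + q + s) ∎
  where
    open ≤-Reasoning
    expand₁ : ∀ p q s → 27 * (p * q * s) ≡ 3 * (p * q * s) + 3 * (q * (2 * (p * s)) + p * (2 * (q * s)) + s * (2 * (p * q))) + 6 * (p * q * s)
    expand₁ = solve-∀
    expand₂ : ∀ p q s → (p * p * p + q * q * q + s * s * s) + 3 * (q * (p * p + s * s) + p * (q * q + s * s) + s * (p * p + q * q)) + 6 * (p * q * s) ≡ (p + q + s) * (p + q + s) * (p + q + s)
    expand₂ = solve-∀

amgm₃ : ∀ p q s z → p * q * s ≡ z * z * z → 3 * z ≤ p + q + s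
amgm₃ p q s z pqs≡z³ = ≮⇒≥ λ σ<3z → <-irrefl refl (begin-strict
  σ * σ * σ                    <⟨ *-mono-< (*-mono-< σ<3z σ<3z) σ<3z ⟩
  (3 * z) * (3 * z) * (3 * z)  ≡⟨ expand z ⟩
  27 * (z * z * z)             ≡⟨ cong (27 *_) pqs≡z³ ⟨
  27 * (p * q * s)             ≤⟨ 27*product≤cube-of-sum p q s ⟩
  σ * σ * σ                    ∎)
  where
    open ≤-Reasoning
    σ : ℕ
    σ = p + q + s
    expand : ∀ z → (3 * z) * (3 * z) * (3 * z) ≡ 27 * (z * z * z)
    expand = solve-∀

-- ⌊K / d⌋ + 1, an integer upper estimate of K / d (junk value 0 at d = 0)
infixl 7 _/⁺_
_/⁺_ : ℕ → ℕ → ℕ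
K /⁺ zero  = 0
K /⁺ suc d = K / suc d + 1

≤-*-/⁺ : ∀ K d → K ≤ suc d * (K /⁺ suc d)
≤-*-/⁺ K d = begin
  K                                 ≡⟨ m≡m%n+[m/n]*n K (suc d) ⟩
  K % suc d + (K / suc d) * suc d   ≤⟨ +-monoˡ-≤ _ (<⇒≤ (m%n<n K (suc d))) ⟩
  suc d + (K / suc d) * suc d       ≡⟨ regroup (suc d) (K / suc d) ⟩
  suc d * (K / suc d + 1)           ∎
  where
    open ≤-Reasoning
    regroup : ∀ a b → a + b * a ≡ a * (b + 1)
    regroup = solve-∀

*-/⁺-≤ : ∀ K d → d * (K /⁺ d) ≤ K + d
*-/⁺-≤ K zero    = z≤n
*-/⁺-≤ K (suc d) = begin
  suc d * (K / suc d + 1)      ≡⟨ regroup (suc d) (K / suc d) ⟩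
  (K / suc d) * suc d + suc d  ≤⟨ +-monoˡ-≤ _ (m/n*n≤m K (suc d)) ⟩
  K + suc d                    ∎
  where
    open ≤-Reasoning
    regroup : ∀ a b → a * (b + 1) ≡ b * a + a
    regroup = solve-∀

-- AM-GM applied to B³xy, T³/y and T³/x, whose product is (BT²)³.
hölder-pointwise : ∀ B T x y → 1 ≤ x → 1 ≤ y →
  3 * B * (T * T) ≤ B * B * B * (x * y) + T * T * T /⁺ y + T * T * T /⁺ x
hölder-pointwise B T (suc x) (suc y) _ _ = *-cancelˡ-≤ (X * Y) (begin
  (X * Y) * (3 * B * (T * T))                                  ≡⟨ regroup₁ B T X Y ⟩
  3 * z                                                        ≤⟨ amgm₃ p (K * X) (K * Y) z (regroup₂ B T X Y) ⟩
  p + K * X + K * Y                                            ≤⟨ +-mono-≤ (+-monoʳ-≤ p (*-monoˡ-≤ X (≤-*-/⁺ K y))) (*-monoˡ-≤ Y (≤-*-/⁺ K x)) ⟩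
  p + (Y * (K /⁺ Y)) * X + (X * (K /⁺ X)) * Y                   ≡⟨ regroup₃ B X Y (K /⁺ Y) (K /⁺ X) ⟩
  (X * Y) * (B * B * B * (X * Y) + K /⁺ Y + K /⁺ X)             ∎)
  where
    open ≤-Reasoning
    X Y K p z : ℕ
    X = suc x
    Y = suc y
    K = T * T * T
    p = B * B * B * (X * Y) * (X * Y)
    z = B * (T * T) * (X * Y)
    regroup₁ : ∀ B T X Y → (X * Y) * (3 * B * (T * T)) ≡ 3 * (B * (T * T) * (X * Y))
    regroup₁ = solve-∀
    regroup₂ : ∀ B T X Y → B * B * B * (X * Y) * (X * Y) * (T * T * T * X) * (T * T * T * Y) ≡ (B * (T * T) * (X * Y)) * (B * (T * T) * (X * Y)) * (B * (T * T) * (X * Y))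
    regroup₂ = solve-∀
    regroup₃ : ∀ B X Y u v → B * B * B * (X * Y) * (X * Y) + (Y * u) * X + (X * v) * Y ≡ (X * Y) * (B * B * B * (X * Y) + u + v)
    regroup₃ = solve-∀

rotate : ∀ {a} {A : Set a} {k} → Vec A (suc k) → Vec A (suc k)
rotate xs = tabulate (lookup xs ∘ next)

module Paths {r n : ℕ} (H : UniformHypergraph r n) where

  _∈ᴱ_ : Fin n → Fin (m H) → Set
  u ∈ᴱ e = u ∈ edge H e

  record Link (a : Fin n) (e : Fin (m H)) (b : Fin n) : Set where
    constructor link
    field
      left∈    : a ∈ᴱ e
      right∈   : b ∈ᴱ e
      apart    : a ≢ b

  Link-sym : ∀ {a e b} → Link a e b → Link b e a
  Link-sym L = record { left∈ = right∈ ; right∈ = left∈ ; apart = apart ∘ sym }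
    where open Link L

  record Path₂ (a : Fin n) (e : Fin (m H)) (b : Fin n) (f : Fin (m H)) (c : Fin n) : Set where
    constructor path₂
    field
      first  : Link a e b
      turn   : e ≢ f
      second : Link b f c

  Path₂-reverse : ∀ {a e b f c} → Path₂ a e b f c → Path₂ c f b e a
  Path₂-reverse P = record { first = Link-sym second ; turn = turn ∘ sym ; second = Link-sym first }
    where open Path₂ P

  record EdgePath (e : Fin (m H)) (a : Fin n) (g : Fin (m H)) (b : Fin n) (f : Fin (m H)) (c : Fin n) : Set where
    constructor edgePath
    field
      start∈ : a ∈ᴱ e
      turn   : e ≢ g
      path   : Path₂ a g b f c

module ShortCycles {r n : ℕ} {H : UniformHypergraph r n} (girth : HasGirth6 H) where

  open Paths H

  no-short-cycle : ∀ {k} {1≤k : True (1 ≤? k)} {k≤4 : True (k ≤? 4)}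
    (vs : Vec (Fin n) (suc k)) (es : Vec (Fin (m H)) (suc k)) → Unique vs → Unique es →
    Pointwise _∈ᴱ_ vs es → Pointwise _∈ᴱ_ (rotate vs) es → ⊥
  no-short-cycle {k} {1≤k} {k≤4} vs es vs-unique es-unique vs∈es rotate-vs∈es =
    girth k (toWitness 1≤k) (toWitness k≤4) record
      { v = lookup vs ; h = lookup es
      ; v-inj = λ {i} {j} → lookup-injective vs-unique i j
      ; h-inj = λ {i} {j} → lookup-injective es-unique i j
      ; v∈h = Pointwise.lookup vs∈es
      ; v'∈h = λ i → subst (_∈ᴱ lookup es i) (lookup∘tabulate (lookup vs ∘ next) i) (Pointwise.lookup rotate-vs∈es i) }

  link-unique : ∀ {a b e f} → Link a e b → Link a f b → e ≡ f
  link-unique {a} {b} {e} {f} (link a∈e b∈e a≢b) (link a∈f b∈f _) with e ≟ f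
  ... | yes e≡f = e≡f
  ... | no e≢f = ⊥-elim (no-short-cycle (a ∷ b ∷ []) (e ∷ f ∷ [])
        ((a≢b ∷ []) ∷ [] ∷ []) ((e≢f ∷ []) ∷ [] ∷ [])
        (a∈e ∷ b∈f ∷ []) (b∈e ∷ a∈f ∷ []))

  link-path₂-⊥ : ∀ {a b c e g g'} → Link a g c → Path₂ a e b g' c → ⊥
  link-path₂-⊥ {a} {b} {c} {e} {g} {g'} (link a∈g c∈g a≢c) (path₂ (link a∈e b∈e a≢b) e≢g' (link b∈g' c∈g' b≢c)) =
    no-short-cycle (a ∷ b ∷ c ∷ []) (e ∷ g' ∷ g ∷ [])
      ((a≢b ∷ a≢c ∷ []) ∷ (b≢c ∷ []) ∷ [] ∷ [])
      ((e≢g' ∷ e≢g ∷ []) ∷ (g'≢g ∷ []) ∷ [] ∷ [])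
      (a∈e ∷ b∈g' ∷ c∈g ∷ [])
      (b∈e ∷ c∈g' ∷ a∈g ∷ [])
    where
      g'≢g : g' ≢ g
      g'≢g refl = e≢g' (link-unique (link a∈e b∈e a≢b) (link a∈g b∈g' a≢b))
      e≢g : e ≢ g
      e≢g refl = e≢g' (link-unique (link b∈e c∈g b≢c) (link b∈g' c∈g' b≢c))

  path₂-ends-apart : ∀ {a b c e f} → Path₂ a e b f c → a ≢ c
  path₂-ends-apart (path₂ first e≢f second) refl = e≢f (link-unique (Link-sym first) second)

  path₂-end∉ : ∀ {a b c e f} → Path₂ a e b f c → ¬ c ∈ᴱ e
  path₂-end∉ (path₂ (link _ b∈e _) e≢f second@(link _ _ b≢c)) c∈e = e≢f (link-unique (link b∈e c∈e b≢c) second)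

  -- Two of these paths with distinct middle vertices close a Berge cycle of length 2, 3 or 4.
  path₂-middle-unique : ∀ {a b b' c e e' f f'} → Path₂ a e b f c → Path₂ a e' b' f' c → b ≡ b'
  path₂-middle-unique {a} {b} {b'} {c} {e} {e'} {f} {f'}
    P@(path₂ (link a∈e b∈e a≢b) e≢f (link b∈f c∈f b≢c))
    (path₂ (link a∈e' b'∈e' a≢b') e'≢f' (link b'∈f' c∈f' b'≢c)) with b ≟ b'
  ... | yes b≡b' = b≡b'
  ... | no b≢b' with e ≟ e' | f ≟ f'
  ...   | yes refl | yes refl = ⊥-elim (e≢f (link-unique (link b∈e b'∈e' b≢b') (link b∈f b'∈f' b≢b')))
  ...   | yes refl | no f≢f' =
    ⊥-elim (link-path₂-⊥ (link b∈e b'∈e' b≢b') (path₂ (link b∈f c∈f b≢c) f≢f' (link c∈f' b'∈f' (b'≢c ∘ sym))))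
  ...   | no e≢e' | yes refl =
    ⊥-elim (link-path₂-⊥ (link b∈f b'∈f' b≢b') (path₂ (link b∈e a∈e (a≢b ∘ sym)) e≢e' (link a∈e' b'∈e' a≢b')))
  ...   | no e≢e' | no f≢f' =
    ⊥-elim (no-short-cycle (a ∷ b ∷ c ∷ b' ∷ []) (e ∷ f ∷ f' ∷ e' ∷ [])
      ((a≢b ∷ path₂-ends-apart P ∷ a≢b' ∷ []) ∷ (b≢c ∷ b≢b' ∷ []) ∷ (b'≢c ∘ sym ∷ []) ∷ [] ∷ [])
      ((e≢f ∷ (λ { refl → path₂-end∉ P c∈f' }) ∷ e≢e' ∷ [])
        ∷ (f≢f' ∷ (λ { refl → path₂-end∉ (Path₂-reverse P) a∈e' }) ∷ [])
        ∷ (e'≢f' ∘ sym ∷ []) ∷ [] ∷ [])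
      (a∈e ∷ b∈f ∷ c∈f' ∷ b'∈e' ∷ [])
      (b∈e ∷ c∈f ∷ b'∈f' ∷ a∈e' ∷ []))

  path₂-unique : ∀ {a b b' c e e' f f'} → Path₂ a e b f c → Path₂ a e' b' f' c → e ≡ e' × b ≡ b' × f ≡ f'
  path₂-unique P P' with path₂-middle-unique P P'
  ... | refl = link-unique (Path₂.first P) (Path₂.first P') , refl , link-unique (Path₂.second P) (Path₂.second P')

  edgePath-middle∉ : ∀ {a b c e f g} → EdgePath e a g b f c → ¬ b ∈ᴱ e
  edgePath-middle∉ (edgePath a∈e e≢g (path₂ first@(link _ _ a≢b) _ _)) b∈e = e≢g (link-unique (link a∈e b∈e a≢b) first)

  edgePath-end∉ : ∀ {a b c e f g} → EdgePath e a g b f c → ¬ c ∈ᴱ e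
  edgePath-end∉ (edgePath a∈e _ P) c∈e = link-path₂-⊥ (link a∈e c∈e (path₂-ends-apart P)) P

  -- Distinct starting vertices close a Berge cycle of length at most 5.
  edgePath-start-unique : ∀ {a a' b b' c e f f' g g'} → EdgePath e a g b f c → EdgePath e a' g' b' f' c → a ≡ a'
  edgePath-start-unique {a} {a'} {b} {b'} {c} {e} {f} {f'} {g} {g'}
    P@(edgePath a∈e e≢g P₂@(path₂ (link a∈g b∈g a≢b) g≢f (link b∈f c∈f b≢c)))
    P'@(edgePath a'∈e e≢g' P'₂@(path₂ (link a'∈g' b'∈g' a'≢b') g'≢f' (link b'∈f' c∈f' b'≢c))) with a ≟ a'
  ... | yes a≡a' = a≡a'
  ... | no a≢a' with b ≟ b'
  ...   | yes refl = ⊥-elim (link-path₂-⊥ (link a∈g b∈g a≢b) (path₂ (link a∈e a'∈e a≢a') e≢g' (link a'∈g' b'∈g' a'≢b')))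
  ...   | no b≢b' with f ≟ f'
  ...     | yes refl = ⊥-elim (e≢g (sym (proj₁ (path₂-unique
              (path₂ (link a∈g b∈g a≢b) g≢f (link b∈f b'∈f' b≢b'))
              (path₂ (link a∈e a'∈e a≢a') e≢g' (link a'∈g' b'∈g' a'≢b'))))))
  ...     | no f≢f' with g ≟ g'
  ...       | yes refl = ⊥-elim (link-path₂-⊥ (link b∈g b'∈g' b≢b') (path₂ (link b∈f c∈f b≢c) f≢f' (link c∈f' b'∈f' (b'≢c ∘ sym))))
  ...       | no g≢g' = ⊥-elim (no-short-cycle (a ∷ b ∷ c ∷ b' ∷ a' ∷ []) (g ∷ f ∷ f' ∷ g' ∷ e ∷ [])
      ((a≢b ∷ path₂-ends-apart P₂ ∷ (λ { refl → edgePath-middle∉ P' a∈e }) ∷ a≢a' ∷ [])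
        ∷ (b≢c ∷ b≢b' ∷ (λ { refl → edgePath-middle∉ P a'∈e }) ∷ [])
        ∷ (b'≢c ∘ sym ∷ (λ { refl → edgePath-end∉ P a'∈e }) ∷ [])
        ∷ (a'≢b' ∘ sym ∷ []) ∷ [] ∷ [])
      ((g≢f ∷ (λ { refl → path₂-end∉ P₂ c∈f' }) ∷ g≢g' ∷ e≢g ∘ sym ∷ [])
        ∷ (f≢f' ∷ (λ { refl → path₂-end∉ P'₂ c∈f }) ∷ (λ { refl → edgePath-middle∉ P b∈f }) ∷ [])
        ∷ (g'≢f' ∘ sym ∷ (λ { refl → edgePath-middle∉ P' b'∈f' }) ∷ [])
        ∷ (e≢g' ∘ sym ∷ []) ∷ [] ∷ [])
      (a∈g ∷ b∈f ∷ c∈f' ∷ b'∈g' ∷ a'∈e ∷ [])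
      (b∈g ∷ c∈f ∷ b'∈f' ∷ a'∈g' ∷ a∈e ∷ []))

  edgePath-unique : ∀ {a a' b b' c e f f' g g'} → EdgePath e a g b f c → EdgePath e a' g' b' f' c →
    a ≡ a' × g ≡ g' × b ≡ b' × f ≡ f'
  edgePath-unique P P' with edgePath-start-unique P P'
  ... | refl = refl , path₂-unique (EdgePath.path P) (EdgePath.path P')

module Counting {r n : ℕ} (H : UniformHypergraph r n) where

  open Paths H

  inc : Fin n → Fin (m H) → ℕ
  inc u e = 𝟙 (lookup (edge H e) u)

  deg : Fin n → ℕ
  deg u = ∑[ e < m H ] inc u e

  inc-positive : ∀ {u e} → 0 < inc u e → u ∈ᴱ e
  inc-positive {u} {e} 0<inc = lookup⇒[]= u (edge H e) (𝟙-positive 0<inc)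

  inc≤1 : ∀ u e → inc u e ≤ 1
  inc≤1 u e = 𝟙≤1 (lookup (edge H e) u)

  edge-size : ∀ e → ∑[ u < n ] inc u e ≡ r
  edge-size e = trans (sum-𝟙-lookup (edge H e)) (uniform H e)

  ∑deg : ∑[ u < n ] deg u ≡ m H * r
  ∑deg = begin
    ∑[ u < n ] ∑[ e < m H ] inc u e  ≡⟨ ∑-comm inc ⟩
    ∑[ e < m H ] ∑[ u < n ] inc u e  ≡⟨ sum-cong-≗ edge-size ⟩
    ∑[ e < m H ] r                   ≡⟨ sum-const (m H) r ⟩
    m H * r                          ∎
    where open ≡-Reasoning

  inc*∑-co-vertices : ∀ a e → inc a e * ∑[ b < n ] (inc b e * ⟦ a ≠ b ⟧) ≡ inc a e * (r ∸ 1)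
  inc*∑-co-vertices a e = trans (𝟙*sum-others (lookup (edge H e)) a) (cong (λ s → inc a e * (s ∸ 1)) (edge-size e))

  inc*∑-co-edges : ∀ a e → inc a e * ∑[ f < m H ] (inc a f * ⟦ e ≠ f ⟧) ≡ inc a e * (deg a ∸ 1)
  inc*∑-co-edges a e = 𝟙*sum-others (λ f → lookup (edge H f) a) e

  𝟙Link : Fin n → Fin (m H) → Fin n → ℕ
  𝟙Link a e b = inc a e * inc b e * ⟦ a ≠ b ⟧

  𝟙Link≤1 : ∀ a e b → 𝟙Link a e b ≤ 1
  𝟙Link≤1 a e b = *-mono-≤ (*-mono-≤ (inc≤1 a e) (inc≤1 b e)) (𝟙≤1 _)

  𝟙Link-positive : ∀ {a e b} → 0 < 𝟙Link a e b → Link a e b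
  𝟙Link-positive 0<L with 0<inc² , 0<≠ ← *-positive⁻¹ 0<L with 0<inc-a , 0<inc-b ← *-positive⁻¹ 0<inc² =
    link (inc-positive 0<inc-a) (inc-positive 0<inc-b) (⟦≠⟧-positive 0<≠)

  𝟙Link-sym : ∀ a e b → 𝟙Link a e b ≡ 𝟙Link b e a
  𝟙Link-sym a e b = cong₂ _*_ (*-comm (inc a e) (inc b e)) (⟦≠⟧-sym a b)

  𝟙Link-guardˡ : ∀ {a e b x y} → inc a e * x ≡ inc a e * y → 𝟙Link a e b * x ≡ 𝟙Link a e b * y
  𝟙Link-guardˡ {a} {e} {b} {x} {y} eq = begin
    𝟙Link a e b * x                        ≡⟨ regroup (inc a e) (inc b e) ⟦ a ≠ b ⟧ x ⟩
    inc b e * ⟦ a ≠ b ⟧ * (inc a e * x)    ≡⟨ cong (inc b e * ⟦ a ≠ b ⟧ *_) eq ⟩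
    inc b e * ⟦ a ≠ b ⟧ * (inc a e * y)    ≡⟨ regroup (inc a e) (inc b e) ⟦ a ≠ b ⟧ y ⟨
    𝟙Link a e b * y                        ∎
    where
      open ≡-Reasoning
      regroup : ∀ i j k x → i * j * k * x ≡ j * k * (i * x)
      regroup = solve-∀

  𝟙Link-guardʳ : ∀ {a e b x y} → inc b e * x ≡ inc b e * y → 𝟙Link a e b * x ≡ 𝟙Link a e b * y
  𝟙Link-guardʳ {a} {e} {b} {x} {y} eq = begin
    𝟙Link a e b * x  ≡⟨ cong (_* x) (𝟙Link-sym a e b) ⟩
    𝟙Link b e a * x  ≡⟨ 𝟙Link-guardˡ eq ⟩
    𝟙Link b e a * y  ≡⟨ cong (_* y) (𝟙Link-sym a e b) ⟨
    𝟙Link a e b * y  ∎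
    where open ≡-Reasoning

  𝟙Link-positive-deg : ∀ {a e b} → 0 < 𝟙Link a e b → 1 ≤ deg a × 1 ≤ deg b
  𝟙Link-positive-deg {a} {e} {b} 0<L with 0<inc² , _ ← *-positive⁻¹ 0<L with 0<inc-a , 0<inc-b ← *-positive⁻¹ 0<inc² =
    ≤-trans 0<inc-a (term≤sum (inc a) e) , ≤-trans 0<inc-b (term≤sum (inc b) e)

  𝟙Link-mono-≤ : ∀ {a e b x y} → (1 ≤ deg a → 1 ≤ deg b → x ≤ y) → 𝟙Link a e b * x ≤ 𝟙Link a e b * y
  𝟙Link-mono-≤ {a} {e} {b} x≤y with 𝟙Link a e b in L≡
  ... | zero  = z≤n
  ... | suc l with 1≤deg-a , 1≤deg-b ← 𝟙Link-positive-deg (subst (0 <_) (sym L≡) (s≤s z≤n)) =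
    *-monoʳ-≤ (suc l) (x≤y 1≤deg-a 1≤deg-b)

  ∑-𝟙Link : ∀ a e → ∑[ b < n ] 𝟙Link a e b ≡ inc a e * (r ∸ 1)
  ∑-𝟙Link a e = begin
    ∑[ b < n ] 𝟙Link a e b                     ≡⟨ sum-cong-≗ (λ b → *-assoc (inc a e) (inc b e) ⟦ a ≠ b ⟧) ⟩
    ∑[ b < n ] (inc a e * (inc b e * ⟦ a ≠ b ⟧)) ≡⟨ *-distribˡ-sum (inc a e) (λ b → inc b e * ⟦ a ≠ b ⟧) ⟨
    inc a e * ∑[ b < n ] (inc b e * ⟦ a ≠ b ⟧) ≡⟨ inc*∑-co-vertices a e ⟩
    inc a e * (r ∸ 1)                          ∎
    where open ≡-Reasoning

  linkSum : (Fin n → Fin n → ℕ) → ℕ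
  linkSum w = ∑³ (λ a e b → 𝟙Link a e b * w a b)

  linkSum-+ : ∀ v w → linkSum (λ a b → v a b + w a b) ≡ linkSum v + linkSum w
  linkSum-+ v w = trans (∑³-cong λ a e b → *-distribˡ-+ (𝟙Link a e b) (v a b) (w a b))
                        (∑³-distrib-+ (λ a e b → 𝟙Link a e b * v a b) (λ a e b → 𝟙Link a e b * w a b))

  linkSum-*ˡ : ∀ x w → linkSum (λ a b → x * w a b) ≡ x * linkSum w
  linkSum-*ˡ x w = trans (∑³-cong λ a e b → x*y*z≡y*[x*z] (𝟙Link a e b) x (w a b))
                         (sym (*-distribˡ-∑³ x λ a e b → 𝟙Link a e b * w a b))
    where
      x*y*z≡y*[x*z] : ∀ x y z → x * (y * z) ≡ y * (x * z)
      x*y*z≡y*[x*z] = solve-∀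

  linkSum-mono-≤ : ∀ {v w} → (∀ a b → 1 ≤ deg a → 1 ≤ deg b → v a b ≤ w a b) → linkSum v ≤ linkSum w
  linkSum-mono-≤ {v} {w} v≤w = ∑³-mono-≤ {F = λ a e b → 𝟙Link a e b * v a b} {G = λ a e b → 𝟙Link a e b * w a b}
                                         (λ a e b → 𝟙Link-mono-≤ (v≤w a b))

  linkSum-cong : ∀ {v w} → (∀ a b → 1 ≤ deg a → 1 ≤ deg b → v a b ≡ w a b) → linkSum v ≡ linkSum w
  linkSum-cong v≡w = ≤-antisym (linkSum-mono-≤ λ a b p q → ≤-reflexive (v≡w a b p q))
                               (linkSum-mono-≤ λ a b p q → ≤-reflexive (sym (v≡w a b p q)))

  linkSum-weightˡ : (h : Fin n → ℕ) → linkSum (λ a _ → h a) ≡ (r ∸ 1) * ∑[ a < n ] (deg a * h a)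
  linkSum-weightˡ h = begin
    linkSum (λ a _ → h a)                                 ≡⟨ sum-cong-≗ (λ a → sum-cong-≗ λ e → sym (*-distribʳ-sum (h a) (𝟙Link a e))) ⟩
    ∑[ a < n ] ∑[ e < m H ] ((∑[ b < n ] 𝟙Link a e b) * h a)
      ≡⟨ sum-cong-≗ (λ a → sum-cong-≗ λ e → trans (cong (_* h a) (∑-𝟙Link a e)) (regroup (inc a e) (r ∸ 1) (h a))) ⟩
    ∑[ a < n ] ∑[ e < m H ] ((r ∸ 1) * h a * inc a e)    ≡⟨ sum-cong-≗ (λ a → *-distribˡ-sum ((r ∸ 1) * h a) (inc a)) ⟨
    ∑[ a < n ] ((r ∸ 1) * h a * deg a)                    ≡⟨ sum-cong-≗ (λ a → regroup′ (r ∸ 1) (h a) (deg a)) ⟩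
    ∑[ a < n ] ((r ∸ 1) * (deg a * h a))                  ≡⟨ *-distribˡ-sum (r ∸ 1) (λ a → deg a * h a) ⟨
    (r ∸ 1) * ∑[ a < n ] (deg a * h a)                    ∎
    where
      open ≡-Reasoning
      regroup : ∀ i R h → i * R * h ≡ R * h * i
      regroup = solve-∀
      regroup′ : ∀ R h d → R * h * d ≡ R * (d * h)
      regroup′ = solve-∀

  linkSum-weightʳ : (h : Fin n → ℕ) → linkSum (λ _ b → h b) ≡ (r ∸ 1) * ∑[ b < n ] (deg b * h b)
  linkSum-weightʳ h = begin
    linkSum (λ _ b → h b)               ≡⟨ ∑-reverse³ (λ a e b → 𝟙Link a e b * h b) ⟩
    ∑³ (λ b e a → 𝟙Link a e b * h b)    ≡⟨ ∑³-cong (λ b e a → cong (_* h b) (𝟙Link-sym a e b)) ⟩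
    linkSum (λ b _ → h b)               ≡⟨ linkSum-weightˡ h ⟩
    (r ∸ 1) * ∑[ b < n ] (deg b * h b)  ∎
    where open ≡-Reasoning

  linkSum-const : ∀ x → linkSum (λ _ _ → x) ≡ (r ∸ 1) * (m H * r) * x
  linkSum-const x = begin
    linkSum (λ _ _ → x)                ≡⟨ linkSum-weightˡ (λ _ → x) ⟩
    (r ∸ 1) * ∑[ a < n ] (deg a * x)   ≡⟨ cong ((r ∸ 1) *_) (*-distribʳ-sum x deg) ⟨
    (r ∸ 1) * (∑[ a < n ] deg a * x)   ≡⟨ cong (λ s → (r ∸ 1) * (s * x)) ∑deg ⟩
    (r ∸ 1) * (m H * r * x)            ≡⟨ *-assoc (r ∸ 1) (m H * r) x ⟨
    (r ∸ 1) * (m H * r) * x            ∎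
    where open ≡-Reasoning

  edgePairs : ℕ
  edgePairs = ∑[ a < n ] (deg a * (deg a ∸ 1))

  degProducts : ℕ
  degProducts = linkSum (λ a b → deg a * deg b)

  excessProducts : ℕ
  excessProducts = linkSum (λ a b → (deg a ∸ 1) * (deg b ∸ 1))

  𝟙Path₂ : Fin n → Fin (m H) → Fin n → Fin (m H) → Fin n → ℕ
  𝟙Path₂ a e b f c = 𝟙Link a e b * ⟦ e ≠ f ⟧ * 𝟙Link b f c

  𝟙EdgePath : Fin (m H) → Fin n → Fin (m H) → Fin n → Fin (m H) → Fin n → ℕ
  𝟙EdgePath e a g b f c = inc a e * ⟦ g ≠ e ⟧ * 𝟙Path₂ a g b f c

  ∑²-𝟙Path₂ : ∀ a e b → ∑[ f < m H ] ∑[ c < n ] 𝟙Path₂ a e b f c ≡ 𝟙Link a e b * ((r ∸ 1) * (deg b ∸ 1))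
  ∑²-𝟙Path₂ a e b = begin
    ∑[ f < m H ] ∑[ c < n ] 𝟙Path₂ a e b f c
      ≡⟨ sum-cong-≗ (λ f → sym (*-distribˡ-sum (L * ⟦ e ≠ f ⟧) (𝟙Link b f))) ⟩
    ∑[ f < m H ] (L * ⟦ e ≠ f ⟧ * ∑[ c < n ] 𝟙Link b f c)
      ≡⟨ sum-cong-≗ (λ f → trans (cong (L * ⟦ e ≠ f ⟧ *_) (∑-𝟙Link b f)) (regroup₁ L ⟦ e ≠ f ⟧ (inc b f) (r ∸ 1))) ⟩
    ∑[ f < m H ] ((r ∸ 1) * (L * (inc b f * ⟦ e ≠ f ⟧)))
      ≡⟨ *-distribˡ-sum (r ∸ 1) (λ f → L * (inc b f * ⟦ e ≠ f ⟧)) ⟨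
    (r ∸ 1) * ∑[ f < m H ] (L * (inc b f * ⟦ e ≠ f ⟧))
      ≡⟨ cong ((r ∸ 1) *_) (*-distribˡ-sum L (λ f → inc b f * ⟦ e ≠ f ⟧)) ⟨
    (r ∸ 1) * (L * ∑[ f < m H ] (inc b f * ⟦ e ≠ f ⟧))
      ≡⟨ cong ((r ∸ 1) *_) (𝟙Link-guardʳ (inc*∑-co-edges b e)) ⟩
    (r ∸ 1) * (L * (deg b ∸ 1))
      ≡⟨ regroup₂ L (r ∸ 1) (deg b ∸ 1) ⟩
    L * ((r ∸ 1) * (deg b ∸ 1))
      ∎
    where
      open ≡-Reasoning
      L : ℕ
      L = 𝟙Link a e b
      regroup₁ : ∀ L d i R → L * d * (i * R) ≡ R * (L * (i * d))
      regroup₁ = solve-∀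
      regroup₂ : ∀ L R s → R * (L * s) ≡ L * (R * s)
      regroup₂ = solve-∀

  ∑-𝟙EdgePath-start : ∀ a g b → ∑[ e < m H ] ∑[ f < m H ] ∑[ c < n ] 𝟙EdgePath e a g b f c ≡
    𝟙Link a g b * ((r ∸ 1) * ((deg a ∸ 1) * (deg b ∸ 1)))
  ∑-𝟙EdgePath-start a g b = begin
    ∑[ e < m H ] ∑[ f < m H ] ∑[ c < n ] 𝟙EdgePath e a g b f c
      ≡⟨ sum-cong-≗ (λ e → sum-cong-≗ λ f → *-distribˡ-sum (inc a e * ⟦ g ≠ e ⟧) (𝟙Path₂ a g b f)) ⟨
    ∑[ e < m H ] ∑[ f < m H ] (inc a e * ⟦ g ≠ e ⟧ * ∑[ c < n ] 𝟙Path₂ a g b f c)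
      ≡⟨ sum-cong-≗ (λ e → *-distribˡ-sum (inc a e * ⟦ g ≠ e ⟧) (λ f → ∑[ c < n ] 𝟙Path₂ a g b f c)) ⟨
    ∑[ e < m H ] (inc a e * ⟦ g ≠ e ⟧ * ∑[ f < m H ] ∑[ c < n ] 𝟙Path₂ a g b f c)
      ≡⟨ sum-cong-≗ (λ e → trans (cong (inc a e * ⟦ g ≠ e ⟧ *_) (∑²-𝟙Path₂ a g b)) (*-comm (inc a e * ⟦ g ≠ e ⟧) W)) ⟩
    ∑[ e < m H ] (W * (inc a e * ⟦ g ≠ e ⟧))
      ≡⟨ *-distribˡ-sum W (λ e → inc a e * ⟦ g ≠ e ⟧) ⟨
    W * ∑[ e < m H ] (inc a e * ⟦ g ≠ e ⟧)
      ≡⟨ regroup₁ (𝟙Link a g b) (r ∸ 1) (deg b ∸ 1) _ ⟩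
    (r ∸ 1) * (deg b ∸ 1) * (𝟙Link a g b * ∑[ e < m H ] (inc a e * ⟦ g ≠ e ⟧))
      ≡⟨ cong ((r ∸ 1) * (deg b ∸ 1) *_) (𝟙Link-guardˡ (inc*∑-co-edges a g)) ⟩
    (r ∸ 1) * (deg b ∸ 1) * (𝟙Link a g b * (deg a ∸ 1))
      ≡⟨ regroup₂ (𝟙Link a g b) (r ∸ 1) (deg a ∸ 1) (deg b ∸ 1) ⟩
    𝟙Link a g b * ((r ∸ 1) * ((deg a ∸ 1) * (deg b ∸ 1)))
      ∎
    where
      open ≡-Reasoning
      W : ℕ
      W = 𝟙Link a g b * ((r ∸ 1) * (deg b ∸ 1))
      regroup₁ : ∀ L R x s → L * (R * x) * s ≡ R * x * (L * s)
      regroup₁ = solve-∀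
      regroup₂ : ∀ L R y x → R * x * (L * y) ≡ L * (R * (y * x))
      regroup₂ = solve-∀

  #Path₂ : ℕ
  #Path₂ = ∑[ a < n ] ∑[ e < m H ] ∑[ b < n ] ∑[ f < m H ] ∑[ c < n ] 𝟙Path₂ a e b f c

  #Path₂≡ : #Path₂ ≡ (r ∸ 1) * (r ∸ 1) * edgePairs
  #Path₂≡ = begin
    #Path₂                                              ≡⟨ ∑³-cong ∑²-𝟙Path₂ ⟩
    linkSum (λ _ b → (r ∸ 1) * (deg b ∸ 1))             ≡⟨ linkSum-*ˡ (r ∸ 1) (λ _ b → deg b ∸ 1) ⟩
    (r ∸ 1) * linkSum (λ _ b → deg b ∸ 1)               ≡⟨ cong ((r ∸ 1) *_) (linkSum-weightʳ (λ b → deg b ∸ 1)) ⟩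
    (r ∸ 1) * ((r ∸ 1) * edgePairs)                     ≡⟨ *-assoc (r ∸ 1) (r ∸ 1) edgePairs ⟨
    (r ∸ 1) * (r ∸ 1) * edgePairs                       ∎
    where open ≡-Reasoning

  #EdgePath : ℕ
  #EdgePath = ∑[ e < m H ] ∑[ a < n ] ∑[ g < m H ] ∑[ b < n ] ∑[ f < m H ] ∑[ c < n ] 𝟙EdgePath e a g b f c

  #EdgePath≡ : #EdgePath ≡ (r ∸ 1) * excessProducts
  #EdgePath≡ = begin
    #EdgePath
      ≡⟨ ∑-pull⁴ (λ a g b e → ∑[ f < m H ] ∑[ c < n ] 𝟙EdgePath e a g b f c) ⟨
    ∑³ (λ a g b → ∑[ e < m H ] ∑[ f < m H ] ∑[ c < n ] 𝟙EdgePath e a g b f c)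
      ≡⟨ ∑³-cong ∑-𝟙EdgePath-start ⟩
    linkSum (λ a b → (r ∸ 1) * ((deg a ∸ 1) * (deg b ∸ 1)))
      ≡⟨ linkSum-*ˡ (r ∸ 1) (λ a b → (deg a ∸ 1) * (deg b ∸ 1)) ⟩
    (r ∸ 1) * excessProducts
      ∎
    where open ≡-Reasoning

  ∑deg² : ∑[ a < n ] (deg a * deg a) ≡ edgePairs + m H * r
  ∑deg² = begin
    ∑[ a < n ] (deg a * deg a)                  ≡⟨ sum-cong-≗ (λ a → square-split (deg a)) ⟩
    ∑[ a < n ] (deg a * (deg a ∸ 1) + deg a)    ≡⟨ ∑-distrib-+ (λ a → deg a * (deg a ∸ 1)) deg ⟩
    edgePairs + ∑[ a < n ] deg a                ≡⟨ cong (edgePairs +_) ∑deg ⟩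
    edgePairs + m H * r                         ∎
    where
      open ≡-Reasoning
      square-split : ∀ d → d * d ≡ d * (d ∸ 1) + d
      square-split zero    = refl
      square-split (suc d) = expand d
        where expand : ∀ d → (1 + d) * (1 + d) ≡ (1 + d) * d + (1 + d)
              expand = solve-∀

  degProducts-identity : degProducts + (r ∸ 1) * (m H * r) ≡ excessProducts + 2 * ((r ∸ 1) * (edgePairs + m H * r))
  degProducts-identity = begin
    degProducts + (r ∸ 1) * (m H * r)
      ≡⟨ cong (degProducts +_) (trans (sym (*-identityʳ _)) (sym (linkSum-const 1))) ⟩
    degProducts + linkSum (λ _ _ → 1)
      ≡⟨ linkSum-+ (λ a b → deg a * deg b) (λ _ _ → 1) ⟨
    linkSum (λ a b → deg a * deg b + 1)
      ≡⟨ linkSum-cong (λ a b → excess-split (deg a) (deg b)) ⟩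
    linkSum (λ a b → (deg a ∸ 1) * (deg b ∸ 1) + deg a + deg b)
      ≡⟨ trans (linkSum-+ (λ a b → (deg a ∸ 1) * (deg b ∸ 1) + deg a) (λ _ b → deg b))
               (cong (_+ linkSum (λ _ b → deg b)) (linkSum-+ (λ a b → (deg a ∸ 1) * (deg b ∸ 1)) (λ a _ → deg a))) ⟩
    excessProducts + linkSum (λ a _ → deg a) + linkSum (λ _ b → deg b)
      ≡⟨ cong₂ (λ x y → excessProducts + x + y) (linkSum-weightˡ deg) (linkSum-weightʳ deg) ⟩
    excessProducts + (r ∸ 1) * ∑[ a < n ] (deg a * deg a) + (r ∸ 1) * ∑[ a < n ] (deg a * deg a)
      ≡⟨ cong (λ s → excessProducts + (r ∸ 1) * s + (r ∸ 1) * s) ∑deg² ⟩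
    excessProducts + (r ∸ 1) * (edgePairs + m H * r) + (r ∸ 1) * (edgePairs + m H * r)
      ≡⟨ m+n+n≡m+2*n excessProducts _ ⟩
    excessProducts + 2 * ((r ∸ 1) * (edgePairs + m H * r))
      ∎
    where
      open ≡-Reasoning
      excess-split : ∀ x y → 1 ≤ x → 1 ≤ y → x * y + 1 ≡ (x ∸ 1) * (y ∸ 1) + x + y
      excess-split (suc x) (suc y) _ _ = expand x y
        where expand : ∀ x y → (1 + x) * (1 + y) + 1 ≡ x * y + (1 + x) + (1 + y)
              expand = solve-∀

  ∑deg*/⁺≤ : ∀ K → ∑[ a < n ] (deg a * (K /⁺ deg a)) ≤ n * K + m H * r
  ∑deg*/⁺≤ K = begin
    ∑[ a < n ] (deg a * (K /⁺ deg a))  ≤⟨ sum-mono-≤ (λ a → *-/⁺-≤ K (deg a)) ⟩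
    ∑[ a < n ] (K + deg a)             ≡⟨ ∑-distrib-+ (λ _ → K) deg ⟩
    ∑[ a < n ] K + ∑[ a < n ] deg a    ≡⟨ cong₂ _+_ (sum-const n K) ∑deg ⟩
    n * K + m H * r                    ∎
    where open ≤-Reasoning

  -- With B = (r - 1) n this is Hölder's inequality T³ ≤ B² · degProducts, up to rounding terms.
  hölder : ∀ B → let T = (r ∸ 1) * (m H * r) in
    T * (3 * B * (T * T)) ≤ B * B * B * degProducts + 2 * ((r ∸ 1) * (n * (T * T * T) + m H * r))
  hölder B = begin
    T * (3 * B * (T * T))
      ≡⟨ linkSum-const _ ⟨
    linkSum (λ _ _ → 3 * B * (T * T))
      ≤⟨ linkSum-mono-≤ (λ a b → hölder-pointwise B T (deg a) (deg b)) ⟩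
    linkSum (λ a b → B * B * B * (deg a * deg b) + K /⁺ deg b + K /⁺ deg a)
      ≡⟨ trans (linkSum-+ (λ a b → B * B * B * (deg a * deg b) + K /⁺ deg b) (λ a _ → K /⁺ deg a))
               (cong (_+ linkSum (λ a _ → K /⁺ deg a)) (linkSum-+ (λ a b → B * B * B * (deg a * deg b)) (λ _ b → K /⁺ deg b))) ⟩
    linkSum (λ a b → B * B * B * (deg a * deg b)) + linkSum (λ _ b → K /⁺ deg b) + linkSum (λ a _ → K /⁺ deg a)
      ≡⟨ cong₂ _+_ (cong₂ _+_ (linkSum-*ˡ (B * B * B) (λ a b → deg a * deg b)) (linkSum-weightʳ (λ b → K /⁺ deg b)))
                   (linkSum-weightˡ (λ a → K /⁺ deg a)) ⟩
    B * B * B * degProducts + (r ∸ 1) * ∑[ a < n ] (deg a * (K /⁺ deg a)) + (r ∸ 1) * ∑[ a < n ] (deg a * (K /⁺ deg a))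
      ≤⟨ +-mono-≤ (+-monoʳ-≤ (B * B * B * degProducts) (*-monoʳ-≤ (r ∸ 1) (∑deg*/⁺≤ K))) (*-monoʳ-≤ (r ∸ 1) (∑deg*/⁺≤ K)) ⟩
    B * B * B * degProducts + (r ∸ 1) * (n * K + m H * r) + (r ∸ 1) * (n * K + m H * r)
      ≡⟨ m+n+n≡m+2*n (B * B * B * degProducts) _ ⟩
    B * B * B * degProducts + 2 * ((r ∸ 1) * (n * K + m H * r))
      ∎
    where
      open ≤-Reasoning
      T K : ℕ
      T = (r ∸ 1) * (m H * r)
      K = T * T * T

module PathBounds {r n : ℕ} {H : UniformHypergraph r n} (girth : HasGirth6 H) where

  open Paths H
  open ShortCycles girth
  open Counting H

  𝟙Path₂≤1 : ∀ a e b f c → 𝟙Path₂ a e b f c ≤ 1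
  𝟙Path₂≤1 a e b f c = *-mono-≤ (*-mono-≤ (𝟙Link≤1 a e b) (𝟙≤1 _)) (𝟙Link≤1 b f c)

  𝟙Path₂-positive : ∀ {a e b f c} → 0 < 𝟙Path₂ a e b f c → Path₂ a e b f c
  𝟙Path₂-positive 0<P with 0<L≠ , 0<L₂ ← *-positive⁻¹ 0<P with 0<L₁ , 0<≠ ← *-positive⁻¹ 0<L≠ =
    path₂ (𝟙Link-positive 0<L₁) (⟦≠⟧-positive 0<≠) (𝟙Link-positive 0<L₂)

  𝟙EdgePath≤1 : ∀ e a g b f c → 𝟙EdgePath e a g b f c ≤ 1
  𝟙EdgePath≤1 e a g b f c = *-mono-≤ (*-mono-≤ (inc≤1 a e) (𝟙≤1 _)) (𝟙Path₂≤1 a g b f c)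

  𝟙EdgePath-positive : ∀ {e a g b f c} → 0 < 𝟙EdgePath e a g b f c → EdgePath e a g b f c
  𝟙EdgePath-positive 0<P with 0<i≠ , 0<P₂ ← *-positive⁻¹ 0<P with 0<inc , 0<≠ ← *-positive⁻¹ 0<i≠ =
    edgePath (inc-positive 0<inc) (⟦≠⟧-positive 0<≠ ∘ sym) (𝟙Path₂-positive 0<P₂)

  #Path₂≤ : #Path₂ ≤ n * n
  #Path₂≤ = begin
    #Path₂                                                  ≡⟨ sum-cong-≗ (λ a → ∑-pull⁴ (𝟙Path₂ a)) ⟩
    ∑[ a < n ] ∑[ c < n ] ∑³ (λ e b f → 𝟙Path₂ a e b f c)
      ≤⟨ sum-mono-≤ {g = λ _ → ∑[ c < n ] 1} (λ a → sum-mono-≤ {g = λ _ → 1} λ c → sum³≤1 (λ e b f → 𝟙Path₂ a e b f c) (λ e b f → 𝟙Path₂≤1 a e b f c)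
                                               (λ p q → path₂-unique (𝟙Path₂-positive p) (𝟙Path₂-positive q))) ⟩
    ∑[ a < n ] ∑[ c < n ] 1                                 ≡⟨ sum²-const-1 n n ⟩
    n * n                                                   ∎
    where open ≤-Reasoning

  #EdgePath≤ : #EdgePath ≤ m H * n
  #EdgePath≤ = begin
    #EdgePath                                                          ≡⟨ sum-cong-≗ (λ e → ∑-pull⁵ (𝟙EdgePath e)) ⟩
    ∑[ e < m H ] ∑[ c < n ] ∑[ a < n ] ∑³ (λ g b f → 𝟙EdgePath e a g b f c)
      ≤⟨ sum-mono-≤ {g = λ _ → ∑[ c < n ] 1} (λ e → sum-mono-≤ {g = λ _ → 1} λ c → sum⁴≤1 (λ a g b f → 𝟙EdgePath e a g b f c) (λ a g b f → 𝟙EdgePath≤1 e a g b f c)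
                                               (λ p q → edgePath-unique (𝟙EdgePath-positive p) (𝟙EdgePath-positive q))) ⟩
    ∑[ e < m H ] ∑[ c < n ] 1                                          ≡⟨ sum²-const-1 (m H) n ⟩
    m H * n                                                            ∎
    where open ≤-Reasoning

-- Beyond this many vertices the terms of lower order cost at most a factor ((c + 1) / c)².
threshold : ℕ → ℕ → ℕ
threshold R c = 9 * (c * c) * (suc R * suc R * suc R) * (R * R) + 3 * c * (R * R) * suc R

module EdgeBound (R₀ n₀ M : ℕ) where

  R r n T B lower : ℕ
  R = suc R₀
  r = suc R
  n = suc n₀
  T = R * (M * r)
  B = R * n
  lower = n * n * n * n + R * R * r * M * (n * n) + r * M

  degProducts-bound : ∀ {A Q P} → R * Q ≤ M * n → R * R * P ≤ n * n → A + T ≡ Q + 2 * (R * (P + M * r)) →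
    R * A ≤ M * n + 2 * (n * n) + 2 * (R * T)
  degProducts-bound {A} {Q} {P} RQ≤Mn RRP≤nn A+T≡ = begin
    R * A                                    ≤⟨ m≤m+n (R * A) (R * T) ⟩
    R * A + R * T                            ≡⟨ *-distribˡ-+ R A T ⟨
    R * (A + T)                              ≡⟨ cong (R *_) A+T≡ ⟩
    R * (Q + 2 * (R * (P + M * r)))          ≡⟨ expand R Q P (M * r) ⟩
    R * Q + 2 * (R * R * P) + 2 * (R * T)    ≤⟨ +-monoˡ-≤ _ (+-mono-≤ RQ≤Mn (*-monoʳ-≤ 2 RRP≤nn)) ⟩
    M * n + 2 * (n * n) + 2 * (R * T)        ∎
    where
      open ≤-Reasoning
      expand : ∀ R Q P X → R * (Q + 2 * (R * (P + X))) ≡ R * Q + 2 * (R * R * P) + 2 * (R * (R * X))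
      expand = solve-∀

  link-cube-bound : ∀ {A} → T * (3 * B * (T * T)) ≤ B * B * B * A + 2 * (R * (n * (T * T * T) + M * r)) →
    B * (T * T * T) ≤ B * B * B * A + 2 * T
  link-cube-bound {A} hölder = +-cancelʳ-≤ (2 * (B * K)) _ _ (begin
    B * K + 2 * (B * K)                          ≡⟨ regroup₁ B T ⟩
    T * (3 * B * (T * T))                        ≤⟨ hölder ⟩
    B * B * B * A + 2 * (R * (n * K + M * r))    ≡⟨ regroup₂ R n K M r (B * B * B * A) ⟩
    B * B * B * A + 2 * T + 2 * (B * K)          ∎)
    where
      open ≤-Reasoning
      K : ℕ
      K = T * T * T
      regroup₁ : ∀ B T → B * (T * T * T) + 2 * (B * (T * T * T)) ≡ T * (3 * B * (T * T))
      regroup₁ = solve-∀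
      regroup₂ : ∀ R n K M r Z → Z + 2 * (R * (n * K + M * r)) ≡ Z + 2 * (R * (M * r)) + 2 * ((R * n) * K)
      regroup₂ = solve-∀

  cubic-edge-bound : ∀ {A} → B * (T * T * T) ≤ B * B * B * A + 2 * T → R * A ≤ M * n + 2 * (n * n) + 2 * (R * T) →
    R * R * (r * r * r) * (M * M * M) ≤ n * n * n * M + 2 * lower
  cubic-edge-bound {A} BK≤ RA≤ = *-cancelˡ-≤ (R * R * R * n) (begin
    (R * R * R * n) * (R * R * (r * r * r) * (M * M * M))     ≡⟨ regroup₁ R n M r ⟩
    R * (B * (T * T * T))                                     ≤⟨ *-monoʳ-≤ R BK≤ ⟩
    R * (B * B * B * A + 2 * T)                               ≡⟨ regroup₂ R n A M r ⟩
    B * B * B * (R * A) + R * R * (2 * (r * M))               ≤⟨ +-mono-≤ (*-monoʳ-≤ (B * B * B) RA≤) (*-monoˡ-≤ (2 * (r * M)) R²≤R³n) ⟩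
    B * B * B * W + (R * R * R * n) * (2 * (r * M))           ≡⟨ regroup₃ R n M r ⟩
    (R * R * R * n) * (n * n * n * M + 2 * lower)             ∎)
    where
      open ≤-Reasoning
      W : ℕ
      W = M * n + 2 * (n * n) + 2 * (R * T)
      R²≤R³n : R * R ≤ R * R * R * n
      R²≤R³n = subst₂ _≤_ (*-identityʳ (R * R)) (sym (*-assoc (R * R) R n)) (*-monoʳ-≤ (R * R) {1} {R * n} (s≤s z≤n))
      regroup₁ : ∀ R n M r → (R * R * R * n) * (R * R * (r * r * r) * (M * M * M)) ≡ R * ((R * n) * ((R * (M * r)) * (R * (M * r)) * (R * (M * r))))
      regroup₁ = solve-∀
      regroup₂ : ∀ R n A M r → R * ((R * n) * (R * n) * (R * n) * A + 2 * (R * (M * r))) ≡ (R * n) * (R * n) * (R * n) * (R * A) + R * R * (2 * (r * M))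
      regroup₂ = solve-∀
      regroup₃ : ∀ R n M r → (R * n) * (R * n) * (R * n) * (M * n + 2 * (n * n) + 2 * (R * (R * (M * r)))) + (R * R * R * n) * (2 * (r * M))
                             ≡ (R * R * R * n) * (n * n * n * M + 2 * (n * n * n * n + R * R * r * M * (n * n) + r * M))
      regroup₃ = solve-∀

  few-edges-bound : ∀ c → threshold R c ≤ n → M ≤ 3 * c * n → R * R * (r * r * r) * (M * M) ≤ n * n * n
  few-edges-bound c N≤n M≤3cn = begin
    R * R * (r * r * r) * (M * M)                       ≤⟨ *-monoʳ-≤ (R * R * (r * r * r)) (*-mono-≤ M≤3cn M≤3cn) ⟩
    R * R * (r * r * r) * ((3 * c * n) * (3 * c * n))   ≡⟨ regroup R r c n ⟩
    (9 * (c * c) * (r * r * r) * (R * R)) * (n * n)     ≤⟨ *-monoˡ-≤ (n * n) (≤-trans (m≤m+n (9 * (c * c) * (r * r * r) * (R * R)) _) N≤n) ⟩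
    n * (n * n)                                         ≡⟨ *-assoc n n n ⟨
    n * n * n                                           ∎
    where
      open ≤-Reasoning
      regroup : ∀ R r c n → R * R * (r * r * r) * ((3 * c * n) * (3 * c * n)) ≡ (9 * (c * c) * (r * r * r) * (R * R)) * (n * n)
      regroup = solve-∀

  c*lower≤n³M : ∀ c → threshold R c ≤ n → 3 * c * n ≤ M → c * lower ≤ n * n * n * M
  c*lower≤n³M c N≤n 3cn≤M = *-cancelˡ-≤ 3 (begin
    3 * (c * lower)                                                               ≡⟨ regroup₁ c n R r M ⟩
    (3 * c * n) * (n * n * n) + (3 * c * (R * R) * r) * (M * (n * n)) + (3 * c * r) * M
      ≤⟨ +-mono-≤ (+-mono-≤ (*-monoˡ-≤ (n * n * n) 3cn≤M) (*-monoˡ-≤ (M * (n * n)) 3cR²r≤n)) (*-monoˡ-≤ M 3cr≤n³) ⟩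
    M * (n * n * n) + n * (M * (n * n)) + (n * n * n) * M                         ≡⟨ regroup₂ n M ⟩
    3 * (n * n * n * M)                                                           ∎)
    where
      open ≤-Reasoning
      3cR²r≤n : 3 * c * (R * R) * r ≤ n
      3cR²r≤n = ≤-trans (m≤n+m (3 * c * (R * R) * r) _) N≤n
      3cr≤n³ : 3 * c * r ≤ n * n * n
      3cr≤n³ = begin
        3 * c * r                  ≤⟨ m≤n*m (3 * c * r) (R * R) ⟩
        (R * R) * (3 * c * r)      ≡⟨ regroup R c r ⟩
        3 * c * (R * R) * r        ≤⟨ 3cR²r≤n ⟩
        n                          ≤⟨ m≤m*n n (n * n) ⟩
        n * (n * n)                ≡⟨ *-assoc n n n ⟨
        n * n * n                  ∎
        where regroup : ∀ R c r → (R * R) * (3 * c * r) ≡ 3 * c * (R * R) * r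
              regroup = solve-∀
      regroup₁ : ∀ c n R r M → 3 * (c * (n * n * n * n + R * R * r * M * (n * n) + r * M)) ≡ (3 * c * n) * (n * n * n) + (3 * c * (R * R) * r) * (M * (n * n)) + (3 * c * r) * M
      regroup₁ = solve-∀
      regroup₂ : ∀ n M → M * (n * n * n) + n * (M * (n * n)) + (n * n * n) * M ≡ 3 * ((n * n * n) * M)
      regroup₂ = solve-∀

  -- Either M ≤ 3cn, which is already small enough, or the lower-order terms are absorbed by (2c + 1) n³ M.
  squared-edge-bound : ∀ c → threshold R c ≤ n → R * R * (r * r * r) * (M * M * M) ≤ n * n * n * M + 2 * lower →
    R * R * (r * r * r) * (M * M) * (c * c) ≤ suc c * suc c * (n * n * n)
  squared-edge-bound c N≤n cubic with M ≤? 3 * c * n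
  ... | yes M≤3cn = begin
    R * R * (r * r * r) * (M * M) * (c * c)   ≤⟨ *-monoˡ-≤ (c * c) (few-edges-bound c N≤n M≤3cn) ⟩
    n * n * n * (c * c)                       ≤⟨ *-monoʳ-≤ (n * n * n) (*-mono-≤ (n≤1+n c) (n≤1+n c)) ⟩
    n * n * n * (suc c * suc c)               ≡⟨ *-comm (n * n * n) _ ⟩
    suc c * suc c * (n * n * n)               ∎
    where open ≤-Reasoning
  ... | no M≰3cn = *-cancelʳ-≤ _ _ M {{>-nonZero (≤-<-trans z≤n 3cn<M)}} (begin
    R * R * (r * r * r) * (M * M) * (c * c) * M       ≡⟨ regroup₁ R r M c ⟩
    (c * c) * (R * R * (r * r * r) * (M * M * M))     ≤⟨ *-monoʳ-≤ (c * c) cubic ⟩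
    (c * c) * (n * n * n * M + 2 * lower)             ≡⟨ regroup₂ c (n * n * n * M) lower ⟩
    c * c * (n * n * n * M) + 2 * c * (c * lower)     ≤⟨ +-monoʳ-≤ (c * c * (n * n * n * M)) (*-monoʳ-≤ (2 * c) (c*lower≤n³M c N≤n (<⇒≤ 3cn<M))) ⟩
    c * c * (n * n * n * M) + 2 * c * (n * n * n * M) ≤⟨ m≤m+n _ (n * n * n * M) ⟩
    c * c * (n * n * n * M) + 2 * c * (n * n * n * M) + n * n * n * M  ≡⟨ regroup₃ c (n * n * n) M ⟩
    suc c * suc c * (n * n * n) * M                   ∎)
    where
      open ≤-Reasoning
      3cn<M : 3 * c * n < M
      3cn<M = ≰⇒> M≰3cn
      regroup₁ : ∀ R r M c → R * R * (r * r * r) * (M * M) * (c * c) * M ≡ (c * c) * (R * R * (r * r * r) * (M * M * M))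
      regroup₁ = solve-∀
      regroup₂ : ∀ c x y → (c * c) * (x + 2 * y) ≡ c * c * x + 2 * c * (c * y)
      regroup₂ = solve-∀
      regroup₃ : ∀ c n³ M → c * c * (n³ * M) + 2 * c * (n³ * M) + n³ * M ≡ (1 + c) * (1 + c) * n³ * M
      regroup₃ = solve-∀

girth6-edge-bound : ∀ {R₀ n₀} (H : UniformHypergraph (suc (suc R₀)) (suc n₀)) → HasGirth6 H →
  ∀ c → threshold (suc R₀) c ≤ suc n₀ →
  suc R₀ * suc R₀ * (suc (suc R₀) * suc (suc R₀) * suc (suc R₀)) * (m H * m H) * (c * c) ≤ suc c * suc c * (suc n₀ * suc n₀ * suc n₀)
girth6-edge-bound {R₀} {n₀} H girth c N≤n =
  squared-edge-bound c N≤n (cubic-edge-bound {degProducts} (link-cube-bound {degProducts} (hölder B))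
    (degProducts-bound {degProducts} {excessProducts} {edgePairs}
      (subst (_≤ m H * n) #EdgePath≡ #EdgePath≤) (subst (_≤ n * n) #Path₂≡ #Path₂≤) degProducts-identity))
  where
    open EdgeBound R₀ n₀ (m H)
    open Counting H
    open PathBounds girth

theorem2 : (r : ℕ) → 2 ≤ r → (k : ℕ) →
    Σ ℕ (λ N → (n : ℕ) → N ≤ n → (H : UniformHypergraph r n) → HasGirth6 H →
      m H ^ 2 * r ^ 3 * (r ∸ 1) ^ 2 * (suc k) ^ 2 ≤ (suc (suc k)) ^ 2 * n ^ 3)
theorem2 (suc zero) (s≤s ()) k
theorem2 (suc (suc R₀)) _ k = threshold (suc R₀) (suc k) , bound
  where
    bound : (n : ℕ) → threshold (suc R₀) (suc k) ≤ n → (H : UniformHypergraph (suc (suc R₀)) n) → HasGirth6 H →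
      m H ^ 2 * suc (suc R₀) ^ 3 * suc R₀ ^ 2 * suc k ^ 2 ≤ suc (suc k) ^ 2 * n ^ 3
    bound zero () H girth
    bound (suc n₀) N≤n H girth = subst₂ _≤_ (reorder (m H) (suc (suc R₀)) (suc R₀) (suc k)) (powers (suc k) (suc n₀))
      (girth6-edge-bound H girth (suc k) N≤n)
      where
        reorder : ∀ M r R c → R * R * (r * r * r) * (M * M) * (c * c) ≡ M * (M * 1) * (r * (r * (r * 1))) * (R * (R * 1)) * (c * (c * 1))
        reorder = solve-∀
        powers : ∀ c n → (1 + c) * (1 + c) * (n * n * n) ≡ (1 + c) * ((1 + c) * 1) * (n * (n * (n * 1)))
        powers = solve-∀
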